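{- Let $m$ and $n$ be positive integers with $n$ odd, and let $q=2^m$. Let $L(x)=\sum_{i=0}^{m-1}a_ix^{2^i}$ with $a_i\in\mathbb{F}_q$ be such that $xL(x)+vx$ is a complete permutation polynomial over $\mathbb{F}_q$ for some $v\in\mathbb{F}_q\setminus\{0,1\}$, and let $g(x)\in\mathbb{F}_q[x]$ be the compositional inverse of $xL(x)+vx$ over $\mathbb{F}_q$. Writing $T=\mathrm{tr}(x)$, the following hold. (1) The polynomial \[\bar F(x)=\frac{x}{v}+\left(\frac{g(T)}{T}+\frac{1}{v}\right)x\,T^{q-1}\] is a complete permutation polynomial over $\mathbb{F}_{q^n}$. (2) For every $u\in\mathbb{F}_q^*$, the polynomial \begin{align*} \tilde F(x)&=\left(1+T^{q-1}\right)\sum_{j=0}^{m-1}\frac{u^{2^j-1}}{v^{2^{j+1}-1}}\left(\sum_{k=0}^{\frac{n-1}{2}}x^{q^{2k}}\right)^{2^j} +\left[T^{q-1}+\left(u^{1/2}g(T)T+T^{3/2}\right)^{q-1}\right]\left(\frac{x}{u}\right)^{1/2}\\ &\quad+\left(u^{1/2}g(T)T+T^{3/2}\right)^{q-1}\left[g(T)+u^{1/2}\sum_{j=0}^{m-1}\left(\frac{T}{u^{1/2}g(T)}+u^{1/2}g(T)\right)^{ -(2^{j+1}-1)}\left(\sum_{k=0}^{\frac{n-1}{2}}x^{q^{2k}}\right)^{2^j}\right] \end{align*} is a complete permutation polynomial over $\mathbb{F}_{q^n}$.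
   Context: A polynomial $f\in\mathbb{F}_Q[x]$ is a permutation polynomial over $\mathbb{F}_Q$ if it induces a bijection of $\mathbb{F}_Q$; it is a complete permutation polynomial if both $f(x)$ and $f(x)+x$ are permutation polynomials. The compositional inverse of a permutation polynomial $f$ over $\mathbb{F}_Q$ is the polynomial $f^{ -1}$ with $f(f^{ -1}(x))\equiv f^{ -1}(f(x))\equiv x\pmod{x^Q-x}$. $\mathrm{tr}(x)=\sum_{i=0}^{n-1}x^{q^i}$ is the trace from $\mathbb{F}_{q^n}$ to $\mathbb{F}_q$. In polynomials over $\mathbb{F}_{2^e}$ (here $e=nm$), $x^{1/2}$ denotes $x^{2^{e-1}}$ and $1/x$ denotes $x^{2^e-2}$ (so $1/0=0$); accordingly $y^{3/2}=y\cdot y^{1/2}$ and $y^{ -k}=(1/y)^k$. -}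

module Defs where

open import Level using (Level; suc; _⊔_)
open import Data.Nat as ℕ using (ℕ; zero; _∸_)
  renaming (suc to sucℕ; _+_ to _+ℕ_; _*_ to _*ℕ_; _^_ to _^ℕ_)
open import Data.Fin using (Fin)
open import Data.List using (List; []; _∷_)
open import Data.List.Relation.Unary.All using (All)
open import Data.Product using (_×_; ∃; _,_)
open import Relation.Binary.PropositionalEquality using (_≡_; _≢_)
open import Relation.Nullary using (¬_)
open import Function.Bundles using (_↔_)
open import Function.Definitions using (Bijective)

record Field (c : Level) : Set (suc c) where
  infixl 7 _*_
  infixl 6 _+_
  field
    Carrier : Set c
    _+_ _*_ : Carrier → Carrier → Carrier
    -_      : Carrier → Carrier
    0# 1#   : Carrier
    +-assoc  : ∀ x y z → (x + y) + z ≡ x + (y + z)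
    +-comm   : ∀ x y → x + y ≡ y + x
    +-identityˡ : ∀ x → 0# + x ≡ x
    -‿inverseˡ : ∀ x → (- x) + x ≡ 0#
    *-assoc  : ∀ x y z → (x * y) * z ≡ x * (y * z)
    *-comm   : ∀ x y → x * y ≡ y * x
    *-identityˡ : ∀ x → 1# * x ≡ x
    distribˡ : ∀ x y z → x * (y + z) ≡ (x * y) + (x * z)
    0≢1      : 0# ≢ 1#
    inverse  : ∀ x → x ≢ 0# → ∃ λ y → y * x ≡ 1#

module FieldOps {c} (K : Field c) where
  open Field K

  _^_ : Carrier → ℕ → Carrier
  x ^ zero = 1#
  x ^ sucℕ k = x * (x ^ k)

  Σ< : ℕ → (ℕ → Carrier) → Carrier
  Σ< zero f = 0#
  Σ< (sucℕ k) f = Σ< k f + f k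

  eval : List Carrier → Carrier → Carrier
  eval [] x = 0#
  eval (a ∷ as) x = a + x * eval as x

-- Setting of the theorem: K is a finite field with Q = 2^(m n) = q^n elements.
module Setting {c} (m n : ℕ) (K : Field c) where
  open Field K public
  open FieldOps K public

  e : ℕ
  e = m *ℕ n

  q : ℕ
  q = 2 ^ℕ m

  Q : ℕ
  Q = 2 ^ℕ e

  -- x^{1/2} := x^{2^{e-1}},  1/x := x^{Q-2} (so 1/0 = 0),  a/b := a * (1/b)
  sqrt : Carrier → Carrier
  sqrt x = x ^ (2 ^ℕ (e ∸ 1))

  inv : Carrier → Carrier
  inv x = x ^ (Q ∸ 2)

  _/_ : Carrier → Carrier → Carrier
  a / b = a * inv b

  InFq : Carrier → Set c
  InFq x = x ^ q ≡ x

  tr : Carrier → Carrier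
  tr x = Σ< n (λ i → x ^ (q ^ℕ i))

  IsPP : (Carrier → Carrier) → Set c
  IsPP f = Bijective _≡_ _≡_ f

  IsCPP : (Carrier → Carrier) → Set c
  IsCPP f = IsPP f × IsPP (λ x → f x + x)

  IsPPFq : (Carrier → Carrier) → Set c
  IsPPFq f = (∀ x → InFq x → InFq (f x))
           × (∀ x y → InFq x → InFq y → f x ≡ f y → x ≡ y)
           × (∀ y → InFq y → ∃ λ x → InFq x × f x ≡ y)

  IsCPPFq : (Carrier → Carrier) → Set c
  IsCPPFq f = IsPPFq f × IsPPFq (λ x → f x + x)

  Lpoly : (ℕ → Carrier) → Carrier → Carrier
  Lpoly a x = Σ< m (λ i → a i * (x ^ (2 ^ℕ i)))

  S : Carrier → Carrier
  S x = Σ< (sucℕ ((n ∸ 1) ℕ./ 2)) (λ k → x ^ (q ^ℕ (2 *ℕ k)))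

  Fbar : (Carrier → Carrier) → Carrier → Carrier → Carrier
  Fbar g v x = let T = tr x in
    (x / v) + ((g T / T) + inv v) * x * (T ^ (q ∸ 1))

  Ftilde : (Carrier → Carrier) → Carrier → Carrier → Carrier → Carrier
  Ftilde g v u x =
    let T = tr x
        A = sqrt u * g T * T + T * sqrt T
        Aq = A ^ (q ∸ 1)
    in ((1# + T ^ (q ∸ 1))
          * Σ< m (λ j → ((u ^ (2 ^ℕ j ∸ 1)) / (v ^ (2 ^ℕ (sucℕ j) ∸ 1))) * (S x ^ (2 ^ℕ j))))
       + ((T ^ (q ∸ 1) + Aq) * sqrt (x / u))
       + (Aq * (g T + sqrt u * Σ< m (λ j →
            (inv ((T / (sqrt u * g T)) + sqrt u * g T) ^ (2 ^ℕ (sucℕ j) ∸ 1)) * (S x ^ (2 ^ℕ j)))))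

{-# OPTIONS --safe #-}
module Submission where

-- Both polynomials are handled by the Akbary–Ghioca–Wang criterion for the trace
-- tr : F_{q^n} → F_q.  Write F for F̄ or F̃ and g for the inverse of f(x) = x L(x) + v x on F_q.
-- Then tr ∘ F = g ∘ tr and tr ∘ (F + id) = (g + id) ∘ tr, and g, g + id are injective on F_q
-- because f is a complete permutation of F_q; so it suffices that F and F + id are injective
-- on each fibre tr⁻¹(T).  There F(x) = c_T + ℓ_T(x) with ℓ_T additive: a scaling for F̄, and
-- for F̃ either x ↦ (x/u)^{1/2} (when u^{1/2} g(T) T + T^{3/2} = 0 ≠ T) or x ↦ γ D(δ S(x)) with
-- D(y) = Σ_{j<m} y^{2^j}, which is the shape of both sums occurring in F̃.  Neither ℓ_T nor
-- ℓ_T + id has a nonzero root of trace 0; for the last shape this comes from the identities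
-- S(x) + S(x)^q = tr x + x (n odd) and D(y)² + D(y) = y^q + y.

open import Defs
open import Data.Nat as ℕ using (ℕ; zero; suc; NonZero; _%_)
  renaming (_+_ to _+ℕ_; _*_ to _*ℕ_; _^_ to _^ℕ_; _∸_ to _∸ℕ_)
import Data.Nat.Properties as ℕₚ
import Data.Nat.DivMod as DM
open import Data.Fin as Fin using (Fin)
import Data.Fin.Properties as Finₚ
open import Data.Fin.Permutation using (permutation)
open import Data.List using (List)
open import Data.List.Relation.Unary.All using (All; []; _∷_)
open import Data.Maybe using (nothing)
open import Data.Product using (_×_; _,_; ∃)
open import Function.Base using (_∘_)
open import Function.Bundles using (_↔_; Inverse)
open import Function.Definitions using (Injective; Bijective)
open import Function.Properties.Inverse using (↔-sym; ↔⇒↣)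
open import Relation.Binary.Definitions using (DecidableEquality)
open import Relation.Binary.PropositionalEquality
open import Relation.Nullary using (yes; no)
open import Relation.Nullary.Decidable using (via-injection)
open import Relation.Nullary.Negation using (contradiction)
open import Algebra.Bundles using (CommutativeRing)
open import Algebra.Consequences.Propositional
  using (comm∧idˡ⇒id; comm∧invˡ⇒inv; comm∧distrˡ⇒distrʳ)
open import Tactic.RingSolver.Core.AlmostCommutativeRing using (fromCommutativeRing)

injective⇒surjective : ∀ {k} (f : Fin k → Fin k) → Injective _≡_ _≡_ f →
                       ∀ y → ∃ λ x → f x ≡ y
injective⇒surjective {zero} f f-injective ()
injective⇒surjective {suc k} f f-injective y with Finₚ.any? (λ i → f i Fin.≟ y)
... | yes hit = hit
... | no miss = contradiction (Finₚ.injective⇒≤ avoid-injective) ℕₚ.1+n≰n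
  where
  avoid : Fin (suc k) → Fin k
  avoid i = Fin.punchOut {i = y} {j = f i} (λ y≡fi → miss (i , sym y≡fi))

  avoid-injective : Injective _≡_ _≡_ avoid
  avoid-injective e = f-injective (Finₚ.punchOut-injective {i = y} _ _ e)

module FieldProperties {c} (K : Field c) where
  open Field K
  open FieldOps K
  open ≡-Reasoning

  commutativeRing : CommutativeRing c c
  commutativeRing = record
    { Carrier = Carrier ; _≈_ = _≡_ ; _+_ = _+_ ; _*_ = _*_ ; -_ = -_ ; 0# = 0# ; 1# = 1#
    ; isCommutativeRing = record
      { isRing = record
        { +-isAbelianGroup = record
          { isGroup = record
            { isMonoid = record
              { isSemigroup = record
                { isMagma = record { isEquivalence = isEquivalence ; ∙-cong = cong₂ _+_ }
                ; assoc = +-assoc }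
              ; identity = comm∧idˡ⇒id +-comm +-identityˡ }
            ; inverse = comm∧invˡ⇒inv +-comm -‿inverseˡ
            ; ⁻¹-cong = cong -_ }
          ; comm = +-comm }
        ; *-cong = cong₂ _*_
        ; *-assoc = *-assoc
        ; *-identity = comm∧idˡ⇒id *-comm *-identityˡ
        ; distrib = distribˡ , comm∧distrˡ⇒distrʳ *-comm distribˡ }
      ; *-comm = *-comm } }

  open CommutativeRing commutativeRing public
    using (+-identityʳ; *-identityʳ; distribʳ; zeroˡ; zeroʳ; *-commutativeMonoid)
  open import Algebra.Properties.AbelianGroup (CommutativeRing.+-abelianGroup commutativeRing) public
    using () renaming (∙-cancelˡ to +-cancelˡ; ⁻¹-involutive to -‿involutive)
  open import Algebra.Properties.Ring (CommutativeRing.ring commutativeRing) public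
    using (-1*x≈-x)
  open import Tactic.RingSolver.NonReflective (fromCommutativeRing commutativeRing (λ _ → nothing)) public
    using (solve; _⊜_; _⊕_; _⊗_)
  open import Algebra.Solver.CommutativeMonoid *-commutativeMonoid public
    using () renaming (solve to *-solve; _⊜_ to _≐_; _⊕_ to _·_)

  *-cancelˡ : ∀ x y z → x ≢ 0# → x * y ≡ x * z → y ≡ z
  *-cancelˡ x y z x≢0 xy≡xz with x⁻¹ , x⁻¹x≡1 ← inverse x x≢0 = begin
    y                ≡⟨ sym (*-identityˡ y) ⟩
    1# * y           ≡⟨ cong (_* y) (sym x⁻¹x≡1) ⟩
    (x⁻¹ * x) * y    ≡⟨ *-assoc x⁻¹ x y ⟩
    x⁻¹ * (x * y)    ≡⟨ cong (x⁻¹ *_) xy≡xz ⟩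
    x⁻¹ * (x * z)    ≡⟨ *-assoc x⁻¹ x z ⟨
    (x⁻¹ * x) * z    ≡⟨ cong (_* z) x⁻¹x≡1 ⟩
    1# * z           ≡⟨ *-identityˡ z ⟩
    z                ∎

  x*y≢0 : ∀ {x y} → x ≢ 0# → y ≢ 0# → x * y ≢ 0#
  x*y≢0 {x} {y} x≢0 y≢0 xy≡0 = y≢0 (*-cancelˡ x y 0# x≢0 (trans xy≡0 (sym (zeroʳ x))))

  1≢0 : 1# ≢ 0#
  1≢0 1≡0 = 0≢1 (sym 1≡0)

  ^-distribˡ-+-* : ∀ x a b → x ^ (a +ℕ b) ≡ x ^ a * x ^ b
  ^-distribˡ-+-* x zero b = sym (*-identityˡ _)
  ^-distribˡ-+-* x (suc a) b = trans (cong (x *_) (^-distribˡ-+-* x a b)) (sym (*-assoc x _ _))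

  ^-distribʳ-* : ∀ x y k → (x * y) ^ k ≡ x ^ k * y ^ k
  ^-distribʳ-* x y zero = sym (*-identityʳ 1#)
  ^-distribʳ-* x y (suc k) = trans (cong ((x * y) *_) (^-distribʳ-* x y k))
    (*-solve 4 (λ x y a b → ((x · y) · (a · b)) ≐ ((x · a) · (y · b))) refl x y (x ^ k) (y ^ k))

  ^-*-assoc : ∀ x a b → (x ^ a) ^ b ≡ x ^ (a *ℕ b)
  ^-*-assoc x a zero = cong (x ^_) (sym (ℕₚ.*-zeroʳ a))
  ^-*-assoc x a (suc b) = begin
    x ^ a * (x ^ a) ^ b    ≡⟨ cong (x ^ a *_) (^-*-assoc x a b) ⟩
    x ^ a * x ^ (a *ℕ b)   ≡⟨ ^-distribˡ-+-* x a (a *ℕ b) ⟨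
    x ^ (a +ℕ a *ℕ b)      ≡⟨ cong (x ^_) (ℕₚ.*-suc a b) ⟨
    x ^ (a *ℕ suc b)       ∎

  ^-^-comm : ∀ x a b → (x ^ a) ^ b ≡ (x ^ b) ^ a
  ^-^-comm x a b = trans (^-*-assoc x a b) (trans (cong (x ^_) (ℕₚ.*-comm a b)) (sym (^-*-assoc x b a)))

  1^≡1 : ∀ k → 1# ^ k ≡ 1#
  1^≡1 zero = refl
  1^≡1 (suc k) = trans (*-identityˡ _) (1^≡1 k)

  0^≡0 : ∀ k → .{{NonZero k}} → 0# ^ k ≡ 0#
  0^≡0 (suc k) = zeroˡ _

  ^≢0 : ∀ x k → x ≢ 0# → x ^ k ≢ 0#
  ^≢0 x zero x≢0 = 1≢0
  ^≢0 x (suc k) x≢0 = x*y≢0 x≢0 (^≢0 x k x≢0)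

  x*x^[k∸1]≡x^k : ∀ x k → .{{NonZero k}} → x * x ^ (k ∸ℕ 1) ≡ x ^ k
  x*x^[k∸1]≡x^k x (suc k) = refl

  x*[x*x^[k∸2]]≡x^k : ∀ x k → 1 ℕ.< k → x * (x * x ^ (k ∸ℕ 2)) ≡ x ^ k
  x*[x*x^[k∸2]]≡x^k x (suc zero) (ℕ.s≤s ())
  x*[x*x^[k∸2]]≡x^k x (suc (suc k)) _ = refl

  x^2≡x*x : ∀ x → x ^ 2 ≡ x * x
  x^2≡x*x x = cong (x *_) (*-identityʳ x)

  select-00 : ∀ s z w → ((1# + 0#) * s + (0# + 0#) * z) + 0# * w ≡ s
  select-00 s z w = begin
    ((1# + 0#) * s + (0# + 0#) * z) + 0# * w   ≡⟨ cong₂ (λ a b → (a * s + b * z) + 0# * w) (+-identityʳ 1#) (+-identityʳ 0#) ⟩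
    (1# * s + 0# * z) + 0# * w                 ≡⟨ cong₂ (λ a b → (a + b) + 0# * w) (*-identityˡ s) (zeroˡ z) ⟩
    (s + 0#) + 0# * w                          ≡⟨ cong₂ _+_ (+-identityʳ s) (zeroˡ w) ⟩
    s + 0#                                     ≡⟨ +-identityʳ s ⟩
    s                                          ∎

  Additive : (Carrier → Carrier) → Set c
  Additive h = ∀ x y → h (x + y) ≡ h x + h y

  additive⇒0↦0 : ∀ {h} → Additive h → h 0# ≡ 0#
  additive⇒0↦0 {h} h-+ = +-cancelˡ (h 0#) (h 0#) 0# (begin
    h 0# + h 0#    ≡⟨ h-+ 0# 0# ⟨
    h (0# + 0#)    ≡⟨ cong h (+-identityˡ 0#) ⟩
    h 0#           ≡⟨ +-identityʳ (h 0#) ⟨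
    h 0# + 0#      ∎)

  Σ<-cong : ∀ N {f g : ℕ → Carrier} → (∀ i → f i ≡ g i) → Σ< N f ≡ Σ< N g
  Σ<-cong zero f≗g = refl
  Σ<-cong (suc N) f≗g = cong₂ _+_ (Σ<-cong N f≗g) (f≗g N)

  Σ<-distrib-+ : ∀ N f g → Σ< N (λ i → f i + g i) ≡ Σ< N f + Σ< N g
  Σ<-distrib-+ zero f g = sym (+-identityʳ 0#)
  Σ<-distrib-+ (suc N) f g = trans (cong (_+ (f N + g N)) (Σ<-distrib-+ N f g))
    (solve 4 (λ a b c d → ((a ⊕ b) ⊕ (c ⊕ d)) ⊜ ((a ⊕ c) ⊕ (b ⊕ d))) refl (Σ< N f) (Σ< N g) (f N) (g N))

  *-distribˡ-Σ< : ∀ N a f → a * Σ< N f ≡ Σ< N (λ i → a * f i)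
  *-distribˡ-Σ< zero a f = zeroʳ a
  *-distribˡ-Σ< (suc N) a f = trans (distribˡ a _ _) (cong (_+ (a * f N)) (*-distribˡ-Σ< N a f))

  Σ<-zero : ∀ N → Σ< N (λ _ → 0#) ≡ 0#
  Σ<-zero zero = refl
  Σ<-zero (suc N) = trans (+-identityʳ _) (Σ<-zero N)

  Σ<-suc : ∀ N f → Σ< (suc N) f ≡ f 0 + Σ< N (f ∘ suc)
  Σ<-suc zero f = trans (+-identityˡ _) (sym (+-identityʳ _))
  Σ<-suc (suc N) f = trans (cong (_+ f (suc N)) (Σ<-suc N f)) (+-assoc _ _ _)

  Σ<-rotate : ∀ N (f : ℕ → Carrier) → f N ≡ f 0 → Σ< N (f ∘ suc) ≡ Σ< N f
  Σ<-rotate zero f fN≡f0 = refl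
  Σ<-rotate (suc N) f fN≡f0 = begin
    Σ< N (f ∘ suc) + f (suc N)   ≡⟨ cong (Σ< N (f ∘ suc) +_) fN≡f0 ⟩
    Σ< N (f ∘ suc) + f 0         ≡⟨ +-comm _ _ ⟩
    f 0 + Σ< N (f ∘ suc)         ≡⟨ Σ<-suc N f ⟨
    Σ< (suc N) f                 ∎

  Σ<-interleave : ∀ H f → Σ< H (λ k → f (k *ℕ 2)) + Σ< H (λ k → f (suc (k *ℕ 2))) ≡ Σ< (H *ℕ 2) f
  Σ<-interleave zero f = +-identityʳ 0#
  Σ<-interleave (suc H) f = begin
    (E + f (H *ℕ 2)) + (O + f (suc (H *ℕ 2)))   ≡⟨ solve 4 (λ E a O b → ((E ⊕ a) ⊕ (O ⊕ b)) ⊜ (((E ⊕ O) ⊕ a) ⊕ b))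
                                                     refl E (f (H *ℕ 2)) O (f (suc (H *ℕ 2))) ⟩
    ((E + O) + f (H *ℕ 2)) + f (suc (H *ℕ 2))   ≡⟨ cong (λ z → (z + f (H *ℕ 2)) + f (suc (H *ℕ 2))) (Σ<-interleave H f) ⟩
    Σ< (suc H *ℕ 2) f                           ∎
    where
    E O : Carrier
    E = Σ< H (λ k → f (k *ℕ 2))
    O = Σ< H (λ k → f (suc (k *ℕ 2)))

  Σ<-homo : ∀ {h} → Additive h → ∀ N f → h (Σ< N f) ≡ Σ< N (h ∘ f)
  Σ<-homo h-+ zero f = additive⇒0↦0 h-+
  Σ<-homo {h} h-+ (suc N) f = trans (h-+ _ _) (cong (_+ h (f N)) (Σ<-homo h-+ N f))

module FiniteField {c} (K : Field c) {N : ℕ} (φ : Fin N ↔ Field.Carrier K) where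
  open Field K
  open FieldOps K
  open FieldProperties K
  open Inverse φ using (to; from; strictlyInverseˡ; strictlyInverseʳ)
  open import Algebra.Properties.CommutativeMonoid.Sum *-commutativeMonoid
    using (sum-cong-≗; ∑-distrib-+; sum-permute; sum-remove; sum-replicate-zero)
    renaming (sum to ∏)
  open ≡-Reasoning

  infix 4 _≟_
  _≟_ : DecidableEquality Carrier
  _≟_ = via-injection (↔⇒↣ (↔-sym φ)) Fin._≟_

  injective⇒bijective : (F : Carrier → Carrier) → (∀ x y → F x ≡ F y → x ≡ y) →
                        Bijective _≡_ _≡_ F
  injective⇒bijective F F-injective = (λ {x} {y} → F-injective x y) , F-surjective
    where
    F′ : Fin N → Fin N
    F′ = from ∘ F ∘ to

    F′-injective : Injective _≡_ _≡_ F′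
    F′-injective {i} {j} F′i≡F′j = begin
      i              ≡⟨ strictlyInverseʳ i ⟨
      from (to i)    ≡⟨ cong from (F-injective _ _ (begin
        F (to i)            ≡⟨ strictlyInverseˡ _ ⟨
        to (F′ i)           ≡⟨ cong to F′i≡F′j ⟩
        to (F′ j)           ≡⟨ strictlyInverseˡ _ ⟩
        F (to j)            ∎)) ⟩
      from (to j)    ≡⟨ strictlyInverseʳ j ⟩
      j              ∎

    F-surjective : ∀ y → ∃ λ x → ∀ {z} → z ≡ x → F z ≡ y
    F-surjective y with i , F′i≡ ← injective⇒surjective F′ F′-injective (from y) =
      to i , λ { refl → trans (sym (strictlyInverseˡ _)) (trans (cong to F′i≡) (strictlyInverseˡ y)) }

  nonzeroPart : Carrier → Carrier
  nonzeroPart x with x ≟ 0#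
  ... | yes _ = 1#
  ... | no _ = x

  onlyAtZero : Carrier → Carrier → Carrier
  onlyAtZero a x with x ≟ 0#
  ... | yes _ = a
  ... | no _ = 1#

  nonzeroPart≢0 : ∀ x → nonzeroPart x ≢ 0#
  nonzeroPart≢0 x with x ≟ 0#
  ... | yes _ = 1≢0
  ... | no x≢0 = x≢0

  nonzeroPart-0 : nonzeroPart 0# ≡ 1#
  nonzeroPart-0 with 0# ≟ 0#
  ... | yes _ = refl
  ... | no 0≢0 = contradiction refl 0≢0

  nonzeroPart-≢0 : ∀ x → x ≢ 0# → nonzeroPart x ≡ x
  nonzeroPart-≢0 x x≢0 with x ≟ 0#
  ... | yes x≡0 = contradiction x≡0 x≢0
  ... | no _ = refl

  onlyAtZero-≢0 : ∀ a x → x ≢ 0# → onlyAtZero a x ≡ 1#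
  onlyAtZero-≢0 a x x≢0 with x ≟ 0#
  ... | yes x≡0 = contradiction x≡0 x≢0
  ... | no _ = refl

  onlyAtZero-0 : ∀ a → onlyAtZero a 0# ≡ a
  onlyAtZero-0 a with 0# ≟ 0#
  ... | yes _ = refl
  ... | no 0≢0 = contradiction refl 0≢0

  *-nonzeroPart : ∀ a x → a ≢ 0# → a * nonzeroPart x ≡ nonzeroPart (a * x) * onlyAtZero a x
  *-nonzeroPart a x a≢0 with x ≟ 0#
  ... | yes refl = begin
    a * 1#                          ≡⟨ *-comm a 1# ⟩
    1# * a                          ≡⟨ cong (_* a) (trans (cong nonzeroPart (zeroʳ a)) nonzeroPart-0) ⟨
    nonzeroPart (a * 0#) * a        ∎
  ... | no x≢0 = begin
    a * x                           ≡⟨ nonzeroPart-≢0 (a * x) (x*y≢0 a≢0 x≢0) ⟨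
    nonzeroPart (a * x)             ≡⟨ *-identityʳ _ ⟨
    nonzeroPart (a * x) * 1#        ∎

  ∏-const : ∀ k a → ∏ {k} (λ _ → a) ≡ a ^ k
  ∏-const zero a = refl
  ∏-const (suc k) a = cong (a *_) (∏-const k a)

  ∏≢0 : ∀ {k} (h : Fin k → Carrier) → (∀ i → h i ≢ 0#) → ∏ h ≢ 0#
  ∏≢0 {zero} h h≢0 = 1≢0
  ∏≢0 {suc k} h h≢0 = x*y≢0 (h≢0 Fin.zero) (∏≢0 (h ∘ Fin.suc) (h≢0 ∘ Fin.suc))

  ∏-single : ∀ {k} (h : Fin k → Carrier) i → (∀ j → j ≢ i → h j ≡ 1#) → ∏ h ≡ h i
  ∏-single {suc k} h i others≡1 = begin
    ∏ h                          ≡⟨ sum-remove {i = i} h ⟩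
    h i * ∏ (h ∘ Fin.punchIn i)  ≡⟨ cong (h i *_) (trans
                                       (sum-cong-≗ (λ j → others≡1 _ (Finₚ.punchInᵢ≢i i j)))
                                       (sum-replicate-zero k)) ⟩
    h i * 1#                     ≡⟨ *-identityʳ (h i) ⟩
    h i                          ∎

  scale : Carrier → Fin N → Fin N
  scale a i = from (a * to i)

  scale-inverse : ∀ a b → b * a ≡ 1# → ∀ i → scale b (scale a i) ≡ i
  scale-inverse a b ba≡1 i = begin
    from (b * to (from (a * to i)))   ≡⟨ cong (λ y → from (b * y)) (strictlyInverseˡ _) ⟩
    from (b * (a * to i))             ≡⟨ cong from (*-assoc b a _) ⟨
    from ((b * a) * to i)             ≡⟨ cong (λ y → from (y * to i)) ba≡1 ⟩
    from (1# * to i)                  ≡⟨ cong from (*-identityˡ _) ⟩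
    from (to i)                       ≡⟨ strictlyInverseʳ i ⟩
    i                                 ∎

  -- x ↦ a x permutes the field, so the product P of the nonzero elements (with 0 counted
  -- as 1) satisfies a ^ N P = a P; onlyAtZero a records the factor a lost at x = 0.
  fermat-≢0 : ∀ a → a ≢ 0# → a ^ N ≡ a
  fermat-≢0 a a≢0 with a⁻¹ , a⁻¹a≡1 ← inverse a a≢0 = *-cancelˡ P (a ^ N) a (∏≢0 _ (nonzeroPart≢0 ∘ to)) (begin
    P * a ^ N                                                     ≡⟨ *-comm P _ ⟩
    a ^ N * P                                                     ≡⟨ cong (_* P) (∏-const N a) ⟨
    ∏ {N} (λ _ → a) * P                                           ≡⟨ ∑-distrib-+ (λ _ → a) (nonzeroPart ∘ to) ⟨
    ∏ {N} (λ i → a * nonzeroPart (to i))                          ≡⟨ sum-cong-≗ (λ i → *-nonzeroPart a (to i) a≢0) ⟩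
    ∏ {N} (λ i → nonzeroPart (a * to i) * onlyAtZero a (to i))    ≡⟨ ∑-distrib-+ (λ i → nonzeroPart (a * to i)) (onlyAtZero a ∘ to) ⟩
    ∏ {N} (λ i → nonzeroPart (a * to i)) * ∏ (onlyAtZero a ∘ to)  ≡⟨ cong₂ _*_ (sym ∏-scaled) ∏-onlyAtZero ⟩
    P * a                                                         ∎)
    where
    P : Carrier
    P = ∏ (nonzeroPart ∘ to)

    ∏-scaled : P ≡ ∏ {N} (λ i → nonzeroPart (a * to i))
    ∏-scaled = trans (sum-permute (nonzeroPart ∘ to)
                       (permutation (scale a) (scale a⁻¹)
                         (scale-inverse a⁻¹ a (trans (*-comm a a⁻¹) a⁻¹a≡1))
                         (scale-inverse a a⁻¹ a⁻¹a≡1)))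
                     (sum-cong-≗ (λ i → cong nonzeroPart (strictlyInverseˡ (a * to i))))

    ∏-onlyAtZero : ∏ (onlyAtZero a ∘ to) ≡ a
    ∏-onlyAtZero = begin
      ∏ (onlyAtZero a ∘ to)          ≡⟨ ∏-single (onlyAtZero a ∘ to) (from 0#) (λ j j≢ → onlyAtZero-≢0 a (to j)
                                          (λ toj≡0 → j≢ (trans (sym (strictlyInverseʳ j)) (cong from toj≡0)))) ⟩
      onlyAtZero a (to (from 0#))    ≡⟨ cong (onlyAtZero a) (strictlyInverseˡ 0#) ⟩
      onlyAtZero a 0#                ≡⟨ onlyAtZero-0 a ⟩
      a                              ∎

  fermat : ∀ x → x ^ N ≡ x
  fermat x with x ≟ 0#
  ... | yes refl = 0^N≡0 (from 0#)
    where
    0^N≡0 : ∀ {k} → Fin k → 0# ^ k ≡ 0#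
    0^N≡0 {suc k} _ = zeroˡ _
  ... | no x≢0 = fermat-≢0 x x≢0

module Characteristic2 {c} (K : Field c) (x+x≡0 : ∀ x → Field._+_ K x x ≡ Field.0# K) where
  open Field K
  open FieldOps K
  open FieldProperties K
  open ≡-Reasoning

  x+y≡0⇒x≡y : ∀ x y → x + y ≡ 0# → x ≡ y
  x+y≡0⇒x≡y x y x+y≡0 = begin
    x              ≡⟨ +-identityʳ x ⟨
    x + 0#         ≡⟨ cong (x +_) (x+x≡0 y) ⟨
    x + (y + y)    ≡⟨ +-assoc x y y ⟨
    (x + y) + y    ≡⟨ cong (_+ y) x+y≡0 ⟩
    0# + y         ≡⟨ +-identityˡ y ⟩
    y              ∎

  x≡y⇒x+y≡0 : ∀ {x y} → x ≡ y → x + y ≡ 0#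
  x≡y⇒x+y≡0 {x} refl = x+x≡0 x

  x+y+y≡x : ∀ x y → (x + y) + y ≡ x
  x+y+y≡x x y = trans (+-assoc x y y) (trans (cong (x +_) (x+x≡0 y)) (+-identityʳ x))

  a+b≡c+d⇒a+c≡b+d : ∀ a b c d → a + b ≡ c + d → a + c ≡ b + d
  a+b≡c+d⇒a+c≡b+d a b c d a+b≡c+d = begin
    a + c                ≡⟨ cong (_+ c) (x+y+y≡x a b) ⟨
    ((a + b) + b) + c    ≡⟨ cong (λ z → (z + b) + c) a+b≡c+d ⟩
    ((c + d) + b) + c    ≡⟨ solve 3 (λ c d b → (((c ⊕ d) ⊕ b) ⊕ c) ⊜ ((b ⊕ d) ⊕ (c ⊕ c))) refl c d b ⟩
    (b + d) + (c + c)    ≡⟨ cong ((b + d) +_) (x+x≡0 c) ⟩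
    (b + d) + 0#         ≡⟨ +-identityʳ _ ⟩
    b + d                ∎

  x*b+[a+b]*x≡a*x : ∀ a b x → x * b + (a + b) * x ≡ a * x
  x*b+[a+b]*x≡a*x a b x = begin
    x * b + (a + b) * x          ≡⟨ cong (x * b +_) (distribʳ x a b) ⟩
    x * b + (a * x + b * x)      ≡⟨ solve 3 (λ x b a → ((x ⊗ b) ⊕ ((a ⊗ x) ⊕ (b ⊗ x))) ⊜ ((a ⊗ x) ⊕ ((x ⊗ b) ⊕ (b ⊗ x)))) refl x b a ⟩
    a * x + (x * b + b * x)      ≡⟨ cong (λ y → a * x + (x * b + y)) (*-comm b x) ⟩
    a * x + (x * b + x * b)      ≡⟨ cong (a * x +_) (x+x≡0 (x * b)) ⟩
    a * x + 0#                   ≡⟨ +-identityʳ _ ⟩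
    a * x                        ∎

  select-10 : ∀ s z w → ((1# + 1#) * s + (1# + 0#) * z) + 0# * w ≡ z
  select-10 s z w = begin
    ((1# + 1#) * s + (1# + 0#) * z) + 0# * w   ≡⟨ cong₂ (λ a b → (a * s + b * z) + 0# * w) (x+x≡0 1#) (+-identityʳ 1#) ⟩
    (0# * s + 1# * z) + 0# * w                 ≡⟨ cong₂ (λ a b → (a + b) + 0# * w) (zeroˡ s) (*-identityˡ z) ⟩
    (0# + z) + 0# * w                          ≡⟨ cong₂ _+_ (+-identityˡ z) (zeroˡ w) ⟩
    z + 0#                                     ≡⟨ +-identityʳ z ⟩
    z                                          ∎

  select-11 : ∀ s z w → ((1# + 1#) * s + (1# + 1#) * z) + 1# * w ≡ w
  select-11 s z w = begin
    ((1# + 1#) * s + (1# + 1#) * z) + 1# * w   ≡⟨ cong (λ a → (a * s + a * z) + 1# * w) (x+x≡0 1#) ⟩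
    (0# * s + 0# * z) + 1# * w                 ≡⟨ cong₂ (λ a b → (a + b) + 1# * w) (zeroˡ s) (zeroˡ z) ⟩
    (0# + 0#) + 1# * w                         ≡⟨ cong₂ _+_ (+-identityʳ 0#) (*-identityˡ w) ⟩
    0# + w                                     ≡⟨ +-identityˡ w ⟩
    w                                          ∎

  frob : ℕ → Carrier → Carrier
  frob k x = x ^ (2 ^ℕ k)

  frob1≡x*x : ∀ x → frob 1 x ≡ x * x
  frob1≡x*x = x^2≡x*x

  ^2-+ : Additive (_^ 2)
  ^2-+ x y = begin
    (x + y) ^ 2                          ≡⟨ x^2≡x*x (x + y) ⟩
    (x + y) * (x + y)                    ≡⟨ solve 2 (λ x y → ((x ⊕ y) ⊗ (x ⊕ y)) ⊜ ((x ⊗ x ⊕ y ⊗ y) ⊕ (x ⊗ y ⊕ x ⊗ y))) refl x y ⟩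
    (x * x + y * y) + (x * y + x * y)    ≡⟨ cong ((x * x + y * y) +_) (x+x≡0 (x * y)) ⟩
    (x * x + y * y) + 0#                 ≡⟨ +-identityʳ _ ⟩
    x * x + y * y                        ≡⟨ cong₂ _+_ (x^2≡x*x x) (x^2≡x*x y) ⟨
    x ^ 2 + y ^ 2                        ∎

  frob-suc : ∀ k x → frob (suc k) x ≡ frob k (x ^ 2)
  frob-suc k x = sym (^-*-assoc x 2 (2 ^ℕ k))

  frob-+ : ∀ k → Additive (frob k)
  frob-+ zero x y = distribʳ 1# x y
  frob-+ (suc k) x y = begin
    frob (suc k) (x + y)              ≡⟨ frob-suc k (x + y) ⟩
    frob k ((x + y) ^ 2)              ≡⟨ cong (frob k) (^2-+ x y) ⟩
    frob k (x ^ 2 + y ^ 2)            ≡⟨ frob-+ k _ _ ⟩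
    frob k (x ^ 2) + frob k (y ^ 2)   ≡⟨ cong₂ _+_ (frob-suc k x) (frob-suc k y) ⟨
    frob (suc k) x + frob (suc k) y   ∎

  frob-* : ∀ k x y → frob k (x * y) ≡ frob k x * frob k y
  frob-* k x y = ^-distribʳ-* x y (2 ^ℕ k)

  frob-0 : ∀ k → frob k 0# ≡ 0#
  frob-0 k = additive⇒0↦0 (frob-+ k)

  frob-frob : ∀ a b x → frob a (frob b x) ≡ frob (b +ℕ a) x
  frob-frob a b x = trans (^-*-assoc x (2 ^ℕ b) (2 ^ℕ a)) (cong (x ^_) (sym (ℕₚ.^-distribˡ-+-* 2 b a)))

  frob-comm : ∀ a b x → frob a (frob b x) ≡ frob b (frob a x)
  frob-comm a b x = ^-^-comm x (2 ^ℕ b) (2 ^ℕ a)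

  frob-Σ< : ∀ k N f → frob k (Σ< N f) ≡ Σ< N (frob k ∘ f)
  frob-Σ< k = Σ<-homo (frob-+ k)

  [wZ⁻¹]²T≡t+t² : ∀ T w Z⁻¹ → (T + w * w) * Z⁻¹ ≡ 1# →
                  (w * Z⁻¹) * (w * Z⁻¹) * T ≡ T * Z⁻¹ + frob 1 (T * Z⁻¹)
  [wZ⁻¹]²T≡t+t² T w Z⁻¹ ZZ⁻¹≡1 = begin
    X                  ≡⟨ x+y+y≡x X (t * t) ⟨
    (X + t * t) + t * t  ≡⟨ cong (_+ t * t) (trans (+-comm X (t * t)) tt+X≡t) ⟩
    t + t * t          ≡⟨ cong (t +_) (frob1≡x*x t) ⟨
    t + frob 1 t       ∎
    where
    t X : Carrier
    t = T * Z⁻¹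
    X = (w * Z⁻¹) * (w * Z⁻¹) * T
    tt+X≡t : t * t + X ≡ t
    tt+X≡t = begin
      t * t + X                     ≡⟨ cong (t * t +_) (*-solve 3 (λ w z T → (((w · z) · (w · z)) · T) ≐ ((T · z) · ((w · w) · z))) refl w Z⁻¹ T) ⟩
      t * t + t * (w * w * Z⁻¹)     ≡⟨ distribˡ t _ _ ⟨
      t * (t + w * w * Z⁻¹)         ≡⟨ cong (t *_) (distribʳ Z⁻¹ T (w * w)) ⟨
      t * ((T + w * w) * Z⁻¹)       ≡⟨ cong (t *_) ZZ⁻¹≡1 ⟩
      t * 1#                        ≡⟨ *-identityʳ t ⟩
      t                             ∎

module TraceSetting {c} (m n : ℕ) .{{m≢0 : NonZero m}} .{{n≢0 : NonZero n}} (n-odd : n % 2 ≡ 1)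
  (K : Field c) (φ : Fin (Setting.Q m n K) ↔ Field.Carrier K) where
  open Setting m n K
  open FieldProperties K
  open FiniteField K φ public using (_≟_)
  open FiniteField K φ using (fermat; injective⇒bijective)
  open ≡-Reasoning

  e≢0 : NonZero e
  e≢0 = ℕₚ.m*n≢0 m n

  1<q : 1 ℕ.< q
  1<q = ℕₚ.^-monoʳ-< 2 (ℕₚ.n<1+n 1) (ℕ.>-nonZero⁻¹ m)

  1<Q : 1 ℕ.< Q
  1<Q = ℕₚ.^-monoʳ-< 2 (ℕₚ.n<1+n 1) (ℕ.>-nonZero⁻¹ e {{e≢0}})

  -1≡1 : - 1# ≡ 1#
  -1≡1 = begin
    - 1#                              ≡⟨ fermat (- 1#) ⟨
    (- 1#) ^ Q                        ≡⟨ cong (λ k → (- 1#) ^ (2 ^ℕ k)) (ℕₚ.suc-pred e {{e≢0}}) ⟨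
    (- 1#) ^ (2 *ℕ 2 ^ℕ ℕ.pred e)     ≡⟨ ^-*-assoc (- 1#) 2 (2 ^ℕ ℕ.pred e) ⟨
    ((- 1#) ^ 2) ^ (2 ^ℕ ℕ.pred e)    ≡⟨ cong (_^ (2 ^ℕ ℕ.pred e)) [-1]^2≡1 ⟩
    1# ^ (2 ^ℕ ℕ.pred e)              ≡⟨ 1^≡1 (2 ^ℕ ℕ.pred e) ⟩
    1#                                ∎
    where
    [-1]^2≡1 : (- 1#) ^ 2 ≡ 1#
    [-1]^2≡1 = trans (x^2≡x*x (- 1#)) (trans (-1*x≈-x (- 1#)) (-‿involutive 1#))

  x+x≡0 : ∀ x → x + x ≡ 0#
  x+x≡0 x = begin
    x + x              ≡⟨ cong₂ _+_ (*-identityʳ x) (*-identityʳ x) ⟨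
    x * 1# + x * 1#    ≡⟨ distribˡ x 1# 1# ⟨
    x * (1# + 1#)      ≡⟨ cong (λ y → x * (y + 1#)) -1≡1 ⟨
    x * (- 1# + 1#)    ≡⟨ cong (x *_) (-‿inverseˡ 1#) ⟩
    x * 0#             ≡⟨ zeroʳ x ⟩
    0#                 ∎

  open Characteristic2 K x+x≡0 public

  frob1-sqrt : ∀ x → frob 1 (sqrt x) ≡ x
  frob1-sqrt x = begin
    frob 1 (sqrt x)         ≡⟨ frob-frob 1 (e ∸ℕ 1) x ⟩
    frob (e ∸ℕ 1 +ℕ 1) x    ≡⟨ cong (λ k → frob k x) (ℕₚ.m∸n+n≡m (ℕ.>-nonZero⁻¹ e {{e≢0}})) ⟩
    x ^ Q                   ≡⟨ fermat x ⟩
    x                       ∎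

  sqrt-frob1 : ∀ x → sqrt (frob 1 x) ≡ x
  sqrt-frob1 x = trans (frob-comm (e ∸ℕ 1) 1 x) (frob1-sqrt x)

  x*inv≡1 : ∀ x → x ≢ 0# → x * inv x ≡ 1#
  x*inv≡1 x x≢0 = *-cancelˡ x _ _ x≢0 (begin
    x * (x * inv x)   ≡⟨ x*[x*x^[k∸2]]≡x^k x Q 1<Q ⟩
    x ^ Q             ≡⟨ fermat x ⟩
    x                 ≡⟨ *-identityʳ x ⟨
    x * 1#            ∎)

  inv*x≡1 : ∀ x → x ≢ 0# → inv x * x ≡ 1#
  inv*x≡1 x x≢0 = trans (*-comm _ x) (x*inv≡1 x x≢0)

  inv-^ : ∀ x k → inv (x ^ k) ≡ inv x ^ k
  inv-^ x k = ^-^-comm x k (Q ∸ℕ 2)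

  inv≢0 : ∀ {x} → x ≢ 0# → inv x ≢ 0#
  inv≢0 {x} = ^≢0 x (Q ∸ℕ 2)

  inv-unique : ∀ x y → x * y ≡ 1# → inv x ≡ y
  inv-unique x y xy≡1 = begin
    inv x              ≡⟨ *-identityʳ _ ⟨
    inv x * 1#         ≡⟨ cong (inv x *_) xy≡1 ⟨
    inv x * (x * y)    ≡⟨ *-assoc _ _ _ ⟨
    (inv x * x) * y    ≡⟨ cong (_* y) (inv*x≡1 x x≢0) ⟩
    1# * y             ≡⟨ *-identityˡ y ⟩
    y                  ∎
    where
    x≢0 : x ≢ 0#
    x≢0 x≡0 = 0≢1 (trans (sym (zeroˡ y)) (trans (cong (_* y) (sym x≡0)) xy≡1))

  InFq-0 : InFq 0#
  InFq-0 = frob-0 m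

  InFq-+ : ∀ {a b} → InFq a → InFq b → InFq (a + b)
  InFq-+ {a} {b} a∈ b∈ = trans (frob-+ m a b) (cong₂ _+_ a∈ b∈)

  InFq-* : ∀ {a b} → InFq a → InFq b → InFq (a * b)
  InFq-* {a} {b} a∈ b∈ = trans (frob-* m a b) (cong₂ _*_ a∈ b∈)

  InFq-^ : ∀ {a} k → InFq a → InFq (a ^ k)
  InFq-^ {a} k a∈ = trans (^-^-comm a k q) (cong (_^ k) a∈)

  InFq-inv : ∀ {a} → InFq a → InFq (inv a)
  InFq-inv = InFq-^ (Q ∸ℕ 2)

  InFq-sqrt : ∀ {a} → InFq a → InFq (sqrt a)
  InFq-sqrt {a} a∈ = trans (frob-comm m (e ∸ℕ 1) a) (cong (frob (e ∸ℕ 1)) a∈)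

  eval-InFq : ∀ {cs} → All InFq cs → ∀ {t} → InFq t → InFq (eval cs t)
  eval-InFq [] t∈ = InFq-0
  eval-InFq (c∈ ∷ cs∈) t∈ = InFq-+ c∈ (InFq-* t∈ (eval-InFq cs∈ t∈))

  InFq⇒^q^i≡ : ∀ {a} → InFq a → ∀ i → a ^ (q ^ℕ i) ≡ a
  InFq⇒^q^i≡ {a} a∈ zero = *-identityʳ a
  InFq⇒^q^i≡ {a} a∈ (suc i) =
    trans (sym (^-*-assoc a q (q ^ℕ i))) (trans (cong (_^ (q ^ℕ i)) a∈) (InFq⇒^q^i≡ a∈ i))

  ^[q∸1]≡1 : ∀ {a} → InFq a → a ≢ 0# → a ^ (q ∸ℕ 1) ≡ 1#
  ^[q∸1]≡1 {a} a∈ a≢0 = *-cancelˡ a _ _ a≢0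
    (trans (x*x^[k∸1]≡x^k a q {{ℕₚ.m^n≢0 2 m}}) (trans a∈ (sym (*-identityʳ a))))

  0^[q∸1]≡0 : 0# ^ (q ∸ℕ 1) ≡ 0#
  0^[q∸1]≡0 = 0^≡0 (q ∸ℕ 1) {{ℕ.>-nonZero (ℕₚ.m<n⇒0<n∸m 1<q)}}

  ^q^i-+ : ∀ i → Additive (_^ (q ^ℕ i))
  ^q^i-+ i x y = trans (^q^i≡frob (x + y))
    (trans (frob-+ (m *ℕ i) x y) (sym (cong₂ _+_ (^q^i≡frob x) (^q^i≡frob y))))
    where
    ^q^i≡frob : ∀ x → x ^ (q ^ℕ i) ≡ frob (m *ℕ i) x
    ^q^i≡frob x = cong (x ^_) (ℕₚ.^-*-assoc 2 m i)

  x^q^n≡x : ∀ x → x ^ (q ^ℕ n) ≡ x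
  x^q^n≡x x = trans (cong (x ^_) (ℕₚ.^-*-assoc 2 m n)) (fermat x)

  frobm-^q^i : ∀ x i → frob m (x ^ (q ^ℕ i)) ≡ x ^ (q ^ℕ suc i)
  frobm-^q^i x i = trans (^-*-assoc x (q ^ℕ i) q) (cong (x ^_) (ℕₚ.*-comm (q ^ℕ i) q))

  -- The trace

  tr-InFq : ∀ x → InFq (tr x)
  tr-InFq x = begin
    frob m (tr x)                         ≡⟨ frob-Σ< m n _ ⟩
    Σ< n (λ i → frob m (x ^ (q ^ℕ i)))    ≡⟨ Σ<-cong n (frobm-^q^i x) ⟩
    Σ< n (λ i → x ^ (q ^ℕ suc i))         ≡⟨ Σ<-rotate n (λ i → x ^ (q ^ℕ i)) (trans (x^q^n≡x x) (sym (*-identityʳ x))) ⟩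
    tr x                                  ∎

  tr-+ : Additive tr
  tr-+ x y = trans (Σ<-cong n (λ i → ^q^i-+ i x y)) (Σ<-distrib-+ n _ _)

  tr-Σ< : ∀ N f → tr (Σ< N f) ≡ Σ< N (tr ∘ f)
  tr-Σ< = Σ<-homo tr-+

  tr-*ˡ : ∀ {a} x → InFq a → tr (a * x) ≡ a * tr x
  tr-*ˡ {a} x a∈ = trans (Σ<-cong n (λ i → trans (^-distribʳ-* a x (q ^ℕ i)) (cong (_* (x ^ (q ^ℕ i))) (InFq⇒^q^i≡ a∈ i))))
                         (sym (*-distribˡ-Σ< n a _))

  tr-frob : ∀ k x → tr (frob k x) ≡ frob k (tr x)
  tr-frob k x = trans (Σ<-cong n (λ i → ^-^-comm x (2 ^ℕ k) (q ^ℕ i))) (sym (frob-Σ< k n _))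

  tr-^q^i : ∀ x i → tr (x ^ (q ^ℕ i)) ≡ tr x
  tr-^q^i x i = trans (Σ<-cong n (λ j → ^-^-comm x (q ^ℕ i) (q ^ℕ j)))
                      (trans (sym (Σ<-homo (^q^i-+ i) n _)) (InFq⇒^q^i≡ (tr-InFq x) i))

  tr-+-fibre : ∀ {x y T} → tr x ≡ T → tr y ≡ T → tr (x + y) ≡ 0#
  tr-+-fibre {x} {y} x∈ y∈ = trans (tr-+ x y) (x≡y⇒x+y≡0 (trans x∈ (sym y∈)))

  half : ℕ
  half = (n ∸ℕ 1) ℕ./ 2

  n≡1+half*2 : n ≡ suc (half *ℕ 2)
  n≡1+half*2 = trans n≡1+[n/2]*2 (cong (λ k → suc (k *ℕ 2)) (sym half≡n/2))
    where
    n≡1+[n/2]*2 : n ≡ suc ((n ℕ./ 2) *ℕ 2)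
    n≡1+[n/2]*2 = trans (DM.m≡m%n+[m/n]*n n 2) (cong (_+ℕ (n ℕ./ 2) *ℕ 2) n-odd)
    half≡n/2 : half ≡ n ℕ./ 2
    half≡n/2 = trans (cong (λ k → (k ∸ℕ 1) ℕ./ 2) n≡1+[n/2]*2) (DM.m*n/n≡m (n ℕ./ 2) 2)

  Σ<-odd-const : ∀ a k → Σ< (suc (k *ℕ 2)) (λ _ → a) ≡ a
  Σ<-odd-const a zero = +-identityˡ a
  Σ<-odd-const a (suc k) = trans (cong (λ z → (z + a) + a) (Σ<-odd-const a k)) (x+y+y≡x a a)

  tr-const : ∀ {a} → InFq a → tr a ≡ a
  tr-const {a} a∈ = trans (Σ<-cong n (InFq⇒^q^i≡ a∈))
    (trans (cong (λ N → Σ< N (λ _ → a)) n≡1+half*2) (Σ<-odd-const a half))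

  -- The additive maps S and D

  S-telescope : ∀ x → S x + frob m (S x) ≡ tr x + x
  S-telescope x = begin
    S x + frob m (S x)                                   ≡⟨ cong (λ z → z + frob m z) S≡E ⟩
    E + frob m E                                         ≡⟨ cong (E +_) frobm-E ⟩
    E + Σ< (suc half) (λ k → conj (suc (k *ℕ 2)))        ≡⟨ Σ<-interleave (suc half) conj ⟩
    Σ< (suc (half *ℕ 2)) conj + conj (suc (half *ℕ 2))   ≡⟨ cong (λ N → Σ< N conj + conj N) n≡1+half*2 ⟨
    tr x + conj n                                        ≡⟨ cong (tr x +_) (x^q^n≡x x) ⟩
    tr x + x                                             ∎
    where
    conj : ℕ → Carrier
    conj i = x ^ (q ^ℕ i)
    E : Carrier
    E = Σ< (suc half) (λ k → conj (k *ℕ 2))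
    S≡E : S x ≡ E
    S≡E = Σ<-cong (suc half) (λ k → cong conj (ℕₚ.*-comm 2 k))
    frobm-E : frob m E ≡ Σ< (suc half) (λ k → conj (suc (k *ℕ 2)))
    frobm-E = trans (frob-Σ< m (suc half) _) (Σ<-cong (suc half) (λ k → frobm-^q^i x (k *ℕ 2)))

  tr≡0⇒≡S+frobmS : ∀ x → tr x ≡ 0# → x ≡ S x + frob m (S x)
  tr≡0⇒≡S+frobmS x tr≡0 = sym (trans (S-telescope x) (trans (cong (_+ x) tr≡0) (+-identityˡ x)))

  S-+ : Additive S
  S-+ x y = trans (Σ<-cong (suc half) (λ k → ^q^i-+ (2 *ℕ k) x y)) (Σ<-distrib-+ (suc half) _ _)

  tr-S : ∀ x → tr (S x) ≡ Σ< (suc half) (λ _ → tr x)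
  tr-S x = trans (tr-Σ< (suc half) _) (Σ<-cong (suc half) (λ k → tr-^q^i x (2 *ℕ k)))

  D : Carrier → Carrier
  D y = Σ< m (λ j → frob j y)

  D-+ : Additive D
  D-+ x y = trans (Σ<-cong m (λ j → frob-+ j x y)) (Σ<-distrib-+ m _ _)

  D-Σ< : ∀ N f → D (Σ< N f) ≡ Σ< N (D ∘ f)
  D-Σ< = Σ<-homo D-+

  tr-D : ∀ y → tr (D y) ≡ D (tr y)
  tr-D y = trans (tr-Σ< m _) (Σ<-cong m (λ j → tr-frob j y))

  D-frob : ∀ k y → D (frob k y) ≡ frob k (D y)
  D-frob k y = trans (Σ<-cong m (λ j → frob-comm j k y)) (sym (frob-Σ< k m _))

  D-telescope : ∀ y → frob 1 (D y) + D y ≡ frob m y + y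
  D-telescope y = begin
    frob 1 (D y) + D y     ≡⟨ cong (_+ D y) frob1-D ⟩
    A + D y                ≡⟨ a+b≡c+d⇒a+c≡b+d A (frob 0 y) (D y) (frob m y)
                                (trans (+-comm A (frob 0 y)) (sym (Σ<-suc m (λ j → frob j y)))) ⟩
    frob 0 y + frob m y    ≡⟨ +-comm _ _ ⟩
    frob m y + frob 0 y    ≡⟨ cong (frob m y +_) (*-identityʳ y) ⟩
    frob m y + y           ∎
    where
    A : Carrier
    A = Σ< m (λ j → frob (suc j) y)
    frob1-D : frob 1 (D y) ≡ A
    frob1-D = trans (frob-Σ< 1 m _)
      (Σ<-cong m (λ j → trans (frob-frob 1 j y) (cong (λ k → frob k y) (ℕₚ.+-comm j 1))))

  D[t+frob1t]≡0 : ∀ {t} → InFq t → D (t + frob 1 t) ≡ 0#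
  D[t+frob1t]≡0 {t} t∈ = begin
    D (t + frob 1 t)        ≡⟨ D-+ t (frob 1 t) ⟩
    D t + D (frob 1 t)      ≡⟨ cong (D t +_) (D-frob 1 t) ⟩
    D t + frob 1 (D t)      ≡⟨ +-comm _ _ ⟩
    frob 1 (D t) + D t      ≡⟨ D-telescope t ⟩
    frob m t + t            ≡⟨ cong (_+ t) t∈ ⟩
    t + t                   ≡⟨ x+x≡0 t ⟩
    0#                      ∎

  D-twist : ∀ a b → a * b ≡ 1# → ∀ y →
            Σ< m (λ j → a ^ (2 ^ℕ suc j ∸ℕ 1) * frob j y) ≡ b * D (a * a * y)
  D-twist a b ab≡1 y = trans (Σ<-cong m term) (sym (*-distribˡ-Σ< m b _))
    where
    term : ∀ j → a ^ (2 ^ℕ suc j ∸ℕ 1) * frob j y ≡ b * frob j (a * a * y)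
    term j = sym (begin
      b * frob j (a * a * y)             ≡⟨ cong (b *_) (frob-* j (a * a) y) ⟩
      b * (frob j (a * a) * frob j y)    ≡⟨ cong (λ z → b * (z * frob j y)) frobj[a*a] ⟩
      b * ((a * a ^ k) * frob j y)       ≡⟨ *-solve 4 (λ b a X Y → (b · ((a · X) · Y)) ≐ ((a · b) · (X · Y)))
                                              refl b a (a ^ k) (frob j y) ⟩
      (a * b) * (a ^ k * frob j y)       ≡⟨ cong (_* (a ^ k * frob j y)) ab≡1 ⟩
      1# * (a ^ k * frob j y)            ≡⟨ *-identityˡ _ ⟩
      a ^ k * frob j y                   ∎)
      where
      k : ℕ
      k = 2 ^ℕ suc j ∸ℕ 1
      frobj[a*a] : frob j (a * a) ≡ a * a ^ k
      frobj[a*a] = begin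
        frob j (a * a)       ≡⟨ cong (frob j) (frob1≡x*x a) ⟨
        frob j (frob 1 a)    ≡⟨ frob-frob j 1 a ⟩
        frob (suc j) a       ≡⟨ x*x^[k∸1]≡x^k a (2 ^ℕ suc j) {{ℕₚ.m^n≢0 2 (suc j)}} ⟨
        a * a ^ k            ∎

  DS : Carrier → Carrier → Carrier → Carrier
  DS γ δ x = γ * D (δ * S x)

  DS-+ : ∀ γ δ → Additive (DS γ δ)
  DS-+ γ δ x y = begin
    γ * D (δ * S (x + y))                    ≡⟨ cong (λ z → γ * D (δ * z)) (S-+ x y) ⟩
    γ * D (δ * (S x + S y))                  ≡⟨ cong (λ z → γ * D z) (distribˡ δ _ _) ⟩
    γ * D (δ * S x + δ * S y)                ≡⟨ cong (γ *_) (D-+ _ _) ⟩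
    γ * (D (δ * S x) + D (δ * S y))          ≡⟨ distribˡ γ _ _ ⟩
    γ * D (δ * S x) + γ * D (δ * S y)        ∎

  tr-DS : ∀ {γ δ x T} → InFq γ → InFq δ → D (δ * T) ≡ 0# → tr x ≡ T → tr (DS γ δ x) ≡ 0#
  tr-DS {γ} {δ} {x} {T} γ∈ δ∈ DδT≡0 x∈ = begin
    tr (γ * D (δ * S x))                  ≡⟨ tr-*ˡ _ γ∈ ⟩
    γ * tr (D (δ * S x))                  ≡⟨ cong (γ *_) (tr-D _) ⟩
    γ * D (tr (δ * S x))                  ≡⟨ cong (λ z → γ * D z) (trans (tr-*ˡ _ δ∈) (cong (δ *_) tr-Sx)) ⟩
    γ * D (δ * Σ< (suc half) (λ _ → T))   ≡⟨ cong (λ z → γ * D z) (*-distribˡ-Σ< (suc half) δ _) ⟩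
    γ * D (Σ< (suc half) (λ _ → δ * T))   ≡⟨ cong (γ *_) (D-Σ< (suc half) _) ⟩
    γ * Σ< (suc half) (λ _ → D (δ * T))   ≡⟨ cong (γ *_) (trans (Σ<-cong (suc half) (λ _ → DδT≡0)) (Σ<-zero (suc half))) ⟩
    γ * 0#                                ≡⟨ zeroʳ γ ⟩
    0#                                    ∎
    where
    tr-Sx : tr (S x) ≡ Σ< (suc half) (λ _ → T)
    tr-Sx = trans (tr-S x) (Σ<-cong (suc half) (λ _ → x∈))

  -- D y = 0 forces y into F_q (by D-telescope), hence S d too, and then d = S d + (S d)^q = 0.
  DS-kernel : ∀ γ δ d → InFq δ → γ ≢ 0# → δ ≢ 0# → tr d ≡ 0# → DS γ δ d ≡ 0# → d ≡ 0#
  DS-kernel γ δ d δ∈ γ≢0 δ≢0 trd≡0 DSd≡0 = begin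
    d                       ≡⟨ tr≡0⇒≡S+frobmS d trd≡0 ⟩
    S d + frob m (S d)      ≡⟨ cong (S d +_) Sd∈ ⟩
    S d + S d               ≡⟨ x+x≡0 (S d) ⟩
    0#                      ∎
    where
    y : Carrier
    y = δ * S d
    Dy≡0 : D y ≡ 0#
    Dy≡0 = *-cancelˡ γ (D y) 0# γ≢0 (trans DSd≡0 (sym (zeroʳ γ)))
    y∈ : InFq y
    y∈ = x+y≡0⇒x≡y _ _ (begin
      frob m y + y            ≡⟨ D-telescope y ⟨
      frob 1 (D y) + D y      ≡⟨ cong (λ z → frob 1 z + z) Dy≡0 ⟩
      frob 1 0# + 0#          ≡⟨ +-identityʳ _ ⟩
      frob 1 0#               ≡⟨ frob-0 1 ⟩
      0#                      ∎)
    Sd∈ : InFq (S d)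
    Sd∈ = *-cancelˡ δ _ _ δ≢0 (trans (cong (_* frob m (S d)) (sym δ∈)) (trans (sym (frob-* m δ (S d))) y∈))

  -- With z = D (δ S d) we get δ d = z² + z and γ z = d, so d (γ²δ) = d (d + γ):
  -- a nonzero d would equal γ²δ + γ ∈ F_q and hence its own trace 0.
  DS+id-kernel : ∀ γ δ d → InFq γ → InFq δ → tr d ≡ 0# → DS γ δ d ≡ d → d ≡ 0#
  DS+id-kernel γ δ d γ∈ δ∈ trd≡0 DSd≡d with d ≟ 0#
  ... | yes d≡0 = d≡0
  ... | no d≢0 = trans (sym (tr-const d∈)) trd≡0
    where
    y z : Carrier
    y = δ * S d
    z = D y
    δd≡z*z+z : δ * d ≡ z * z + z
    δd≡z*z+z = begin
      δ * d                           ≡⟨ cong (δ *_) (tr≡0⇒≡S+frobmS d trd≡0) ⟩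
      δ * (S d + frob m (S d))        ≡⟨ distribˡ δ _ _ ⟩
      y + δ * frob m (S d)            ≡⟨ cong (λ w → y + w * frob m (S d)) (sym δ∈) ⟩
      y + frob m δ * frob m (S d)     ≡⟨ cong (y +_) (frob-* m δ (S d)) ⟨
      y + frob m y                    ≡⟨ +-comm _ _ ⟩
      frob m y + y                    ≡⟨ D-telescope y ⟨
      frob 1 z + z                    ≡⟨ cong (_+ z) (frob1≡x*x z) ⟩
      z * z + z                       ∎
    dγγδ≡d[d+γ] : d * (γ * γ * δ) ≡ d * (d + γ)
    dγγδ≡d[d+γ] = begin
      d * (γ * γ * δ)                   ≡⟨ *-solve 4 (λ d g g′ δ → (d · ((g · g′) · δ)) ≐ ((g · g′) · (δ · d))) refl d γ γ δ ⟩
      γ * γ * (δ * d)                   ≡⟨ cong (γ * γ *_) δd≡z*z+z ⟩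
      γ * γ * (z * z + z)               ≡⟨ distribˡ (γ * γ) _ _ ⟩
      γ * γ * (z * z) + γ * γ * z       ≡⟨ cong₂ _+_ (*-solve 3 (λ g g′ z → ((g · g′) · (z · z)) ≐ ((g · z) · (g′ · z))) refl γ γ z)
                                                     (*-assoc γ γ z) ⟩
      (γ * z) * (γ * z) + γ * (γ * z)   ≡⟨ cong (λ w → w * w + γ * w) DSd≡d ⟩
      d * d + γ * d                     ≡⟨ cong (d * d +_) (*-comm γ d) ⟩
      d * d + d * γ                     ≡⟨ distribˡ d d γ ⟨
      d * (d + γ)                       ∎
    d∈ : InFq d
    d∈ = subst InFq (trans (cong (_+ γ) (*-cancelˡ d _ _ d≢0 dγγδ≡d[d+γ])) (x+y+y≡x d γ))
               (InFq-+ (InFq-* (InFq-* γ∈ γ∈) δ∈) γ∈)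

  -- Permutations that are affine on the fibres of the trace

  InjectiveOnFq : (Carrier → Carrier) → Set c
  InjectiveOnFq h = ∀ s t → InFq s → InFq t → h s ≡ h t → s ≡ t

  agw-criterion : ∀ F h → (∀ x → tr (F x) ≡ h (tr x)) → InjectiveOnFq h →
                  (∀ x y → tr x ≡ tr y → F x ≡ F y → x ≡ y) → IsPP F
  agw-criterion F h tr∘F≡h∘tr h-injective fibre-injective = injective⇒bijective F F-injective
    where
    F-injective : ∀ x y → F x ≡ F y → x ≡ y
    F-injective x y Fx≡Fy = fibre-injective x y (h-injective _ _ (tr-InFq x) (tr-InFq y)
      (trans (sym (tr∘F≡h∘tr x)) (trans (cong tr Fx≡Fy) (tr∘F≡h∘tr y)))) Fx≡Fy

  record AffineOnFibre (F g : Carrier → Carrier) (T : Carrier) : Set c where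
    field
      offset           : Carrier
      linear           : Carrier → Carrier
      linear-+         : Additive linear
      linear-kernel    : ∀ d → tr d ≡ 0# → linear d ≡ 0# → d ≡ 0#
      linear+id-kernel : ∀ d → tr d ≡ 0# → linear d ≡ d → d ≡ 0#
      F≡offset+linear  : ∀ x → tr x ≡ T → F x ≡ offset + linear x
      tr∘F≡g           : ∀ x → tr x ≡ T → tr (F x) ≡ g T

    fibre-injective : ∀ x y → tr x ≡ T → tr y ≡ T → F x ≡ F y → x ≡ y
    fibre-injective x y x∈ y∈ Fx≡Fy =
      x+y≡0⇒x≡y x y (linear-kernel (x + y) (tr-+-fibre x∈ y∈) (trans (linear-+ x y) (x≡y⇒x+y≡0 ℓx≡ℓy)))
      where
      ℓx≡ℓy : linear x ≡ linear y
      ℓx≡ℓy = +-cancelˡ offset _ _ (trans (sym (F≡offset+linear x x∈)) (trans Fx≡Fy (F≡offset+linear y y∈)))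

    fibre-injective+id : ∀ x y → tr x ≡ T → tr y ≡ T → F x + x ≡ F y + y → x ≡ y
    fibre-injective+id x y x∈ y∈ Fx+x≡Fy+y =
      x+y≡0⇒x≡y x y (linear+id-kernel (x + y) (tr-+-fibre x∈ y∈)
        (trans (linear-+ x y) (a+b≡c+d⇒a+c≡b+d _ _ _ _ ℓx+x≡ℓy+y)))
      where
      ℓx+x≡ℓy+y : linear x + x ≡ linear y + y
      ℓx+x≡ℓy+y = +-cancelˡ offset _ _ (begin
        offset + (linear x + x)    ≡⟨ +-assoc _ _ _ ⟨
        (offset + linear x) + x    ≡⟨ cong (_+ x) (F≡offset+linear x x∈) ⟨
        F x + x                    ≡⟨ Fx+x≡Fy+y ⟩
        F y + y                    ≡⟨ cong (_+ y) (F≡offset+linear y y∈) ⟩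
        (offset + linear y) + y    ≡⟨ +-assoc _ _ _ ⟩
        offset + (linear y + y)    ∎)

  isCPP-fibrewise : ∀ F g → InjectiveOnFq g → InjectiveOnFq (λ t → g t + t) →
                    (∀ T → InFq T → AffineOnFibre F g T) → IsCPP F
  isCPP-fibrewise F g g-injective g+id-injective affine =
      agw-criterion F g (λ x → tr∘F≡g (fibre x) x refl) g-injective
        (λ x y trx≡try → fibre-injective (fibre x) x y refl (sym trx≡try))
    , agw-criterion (λ x → F x + x) (λ t → g t + t)
        (λ x → trans (tr-+ (F x) x) (cong (_+ tr x) (tr∘F≡g (fibre x) x refl))) g+id-injective
        (λ x y trx≡try → fibre-injective+id (fibre x) x y refl (sym trx≡try))
    where
    open AffineOnFibre
    fibre : ∀ x → AffineOnFibre F g (tr x)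
    fibre x = affine (tr x) (tr-InFq x)

  scaling-onFibre : ∀ {F g T} a → InFq a → a ≢ 0# → a ≢ 1# →
                    (∀ x → tr x ≡ T → F x ≡ a * x) → a * T ≡ g T → AffineOnFibre F g T
  scaling-onFibre a a∈ a≢0 a≢1 F≡a* aT≡gT = record
    { offset           = 0#
    ; linear           = a *_
    ; linear-+         = distribˡ a
    ; linear-kernel    = λ d _ ad≡0 → *-cancelˡ a d 0# a≢0 (trans ad≡0 (sym (zeroʳ a)))
    ; linear+id-kernel = λ d _ → fixed-point d
    ; F≡offset+linear  = λ x x∈ → trans (F≡a* x x∈) (sym (+-identityˡ _))
    ; tr∘F≡g           = λ x x∈ → trans (cong tr (F≡a* x x∈)) (trans (tr-*ˡ x a∈) (trans (cong (a *_) x∈) aT≡gT))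
    }
    where
    fixed-point : ∀ d → a * d ≡ d → d ≡ 0#
    fixed-point d ad≡d with d ≟ 0#
    ... | yes d≡0 = d≡0
    ... | no d≢0 = contradiction (*-cancelˡ d a 1# d≢0 (trans (*-comm d a) (trans ad≡d (sym (*-identityʳ d))))) a≢1

  sqrt-scaling-onFibre : ∀ {F g T} a → InFq a → a ≢ 0# →
                         (∀ x → tr x ≡ T → F x ≡ sqrt (x * a)) → sqrt (a * T) ≡ g T → AffineOnFibre F g T
  sqrt-scaling-onFibre {F} {g} {T} a a∈ a≢0 F≡√[a*] √[aT]≡gT = record
    { offset           = 0#
    ; linear           = λ x → sqrt (x * a)
    ; linear-+         = λ x y → trans (cong sqrt (distribʳ a x y)) (frob-+ (e ∸ℕ 1) _ _)
    ; linear-kernel    = λ d _ → kernel d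
    ; linear+id-kernel = kernel+id
    ; F≡offset+linear  = λ x x∈ → trans (F≡√[a*] x x∈) (sym (+-identityˡ _))
    ; tr∘F≡g           = λ x x∈ → begin
        tr (F x)                ≡⟨ cong tr (F≡√[a*] x x∈) ⟩
        tr (sqrt (x * a))       ≡⟨ tr-frob (e ∸ℕ 1) _ ⟩
        sqrt (tr (x * a))       ≡⟨ cong (sqrt ∘ tr) (*-comm x a) ⟩
        sqrt (tr (a * x))       ≡⟨ cong sqrt (trans (tr-*ˡ x a∈) (cong (a *_) x∈)) ⟩
        sqrt (a * T)            ≡⟨ √[aT]≡gT ⟩
        g T                     ∎
    }
    where
    da≡frob1 : ∀ {d y} → sqrt (d * a) ≡ y → d * a ≡ frob 1 y
    da≡frob1 {d} √[da]≡y = trans (sym (frob1-sqrt (d * a))) (cong (frob 1) √[da]≡y)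

    kernel : ∀ d → sqrt (d * a) ≡ 0# → d ≡ 0#
    kernel d √[da]≡0 = *-cancelˡ a d 0# a≢0
      (trans (*-comm a d) (trans (da≡frob1 √[da]≡0) (trans (frob-0 1) (sym (zeroʳ a)))))

    kernel+id : ∀ d → tr d ≡ 0# → sqrt (d * a) ≡ d → d ≡ 0#
    kernel+id d trd≡0 √[da]≡d with d ≟ 0#
    ... | yes d≡0 = d≡0
    ... | no d≢0 = trans (sym (tr-const (subst InFq a≡d a∈))) trd≡0
      where
      a≡d : a ≡ d
      a≡d = *-cancelˡ d a d d≢0 (trans (da≡frob1 √[da]≡d) (frob1≡x*x d))

  DS-onFibre : ∀ {F g T} γ δ o → InFq γ → InFq δ → γ ≢ 0# → δ ≢ 0# → InFq o → o ≡ g T →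
               D (δ * T) ≡ 0# → (∀ x → tr x ≡ T → F x ≡ o + DS γ δ x) → AffineOnFibre F g T
  DS-onFibre {F} {g} {T} γ δ o γ∈ δ∈ γ≢0 δ≢0 o∈ o≡gT DδT≡0 F≡o+DS = record
    { offset           = o
    ; linear           = DS γ δ
    ; linear-+         = DS-+ γ δ
    ; linear-kernel    = λ d → DS-kernel γ δ d δ∈ γ≢0 δ≢0
    ; linear+id-kernel = λ d → DS+id-kernel γ δ d γ∈ δ∈
    ; F≡offset+linear  = F≡o+DS
    ; tr∘F≡g           = λ x x∈ → begin
        tr (F x)                  ≡⟨ cong tr (F≡o+DS x x∈) ⟩
        tr (o + DS γ δ x)         ≡⟨ tr-+ o _ ⟩
        tr o + tr (DS γ δ x)      ≡⟨ cong₂ _+_ (tr-const o∈) (tr-DS γ∈ δ∈ DδT≡0 x∈) ⟩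
        o + 0#                    ≡⟨ +-identityʳ o ⟩
        o                         ≡⟨ o≡gT ⟩
        g T                       ∎
    }

  module CompletePermutations
    (f g : Carrier → Carrier) (g-InFq : ∀ t → InFq t → InFq (g t)) (f0≡0 : f 0# ≡ 0#)
    (g∘f≡id : ∀ x → InFq x → g (f x) ≡ x) (f∘g≡id : ∀ x → InFq x → f (g x) ≡ x)
    (f+id-injective : InjectiveOnFq (λ x → f x + x))
    (v : Carrier) (v∈ : InFq v) (v≢0 : v ≢ 0#) (v≢1 : v ≢ 1#) where

    g-0 : g 0# ≡ 0#
    g-0 = trans (cong g (sym f0≡0)) (g∘f≡id 0# InFq-0)

    g-injective : InjectiveOnFq g
    g-injective s t s∈ t∈ gs≡gt = trans (sym (f∘g≡id s s∈)) (trans (cong f gs≡gt) (f∘g≡id t t∈))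

    g+id-injective : InjectiveOnFq (λ t → g t + t)
    g+id-injective s t s∈ t∈ gs+s≡gt+t = g-injective s t s∈ t∈
      (f+id-injective (g s) (g t) (g-InFq s s∈) (g-InFq t t∈) (begin
        f (g s) + g s    ≡⟨ cong (_+ g s) (f∘g≡id s s∈) ⟩
        s + g s          ≡⟨ +-comm s (g s) ⟩
        g s + s          ≡⟨ gs+s≡gt+t ⟩
        g t + t          ≡⟨ +-comm (g t) t ⟩
        t + g t          ≡⟨ cong (_+ g t) (f∘g≡id t t∈) ⟨
        f (g t) + g t    ∎))

    g≢0 : ∀ {T} → InFq T → T ≢ 0# → g T ≢ 0#
    g≢0 {T} T∈ T≢0 gT≡0 = T≢0 (trans (sym (f∘g≡id T T∈)) (trans (cong f gT≡0) f0≡0))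

    g≢id : ∀ {T} → InFq T → T ≢ 0# → g T ≢ T
    g≢id {T} T∈ T≢0 gT≡T = T≢0 (g+id-injective T 0# T∈ InFq-0
      (trans (x≡y⇒x+y≡0 gT≡T) (sym (trans (cong (_+ 0#) g-0) (+-identityʳ 0#)))))

    Fbar-on : ∀ x {T} → tr x ≡ T → Fbar g v x ≡ x / v + (g T / T + inv v) * x * T ^ (q ∸ℕ 1)
    Fbar-on x = cong (λ T → x / v + (g T / T + inv v) * x * T ^ (q ∸ℕ 1))

    Fbar-onFibre : ∀ T → InFq T → AffineOnFibre (Fbar g v) g T
    Fbar-onFibre T T∈ with T ≟ 0#
    ... | yes refl = scaling-onFibre (inv v) (InFq-inv v∈) (inv≢0 v≢0) v⁻¹≢1 Fbar≡v⁻¹* (trans (zeroʳ _) (sym g-0))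
      where
      v⁻¹≢1 : inv v ≢ 1#
      v⁻¹≢1 v⁻¹≡1 = v≢1 (trans (sym (*-identityʳ v)) (trans (cong (v *_) (sym v⁻¹≡1)) (x*inv≡1 v v≢0)))
      Fbar≡v⁻¹* : ∀ x → tr x ≡ 0# → Fbar g v x ≡ inv v * x
      Fbar≡v⁻¹* x trx≡0 = begin
        Fbar g v x                                         ≡⟨ Fbar-on x trx≡0 ⟩
        x / v + (g 0# / 0# + inv v) * x * 0# ^ (q ∸ℕ 1)    ≡⟨ cong (λ z → x / v + (g 0# / 0# + inv v) * x * z) 0^[q∸1]≡0 ⟩
        x / v + (g 0# / 0# + inv v) * x * 0#               ≡⟨ cong (x / v +_) (zeroʳ _) ⟩
        x / v + 0#                                         ≡⟨ +-identityʳ _ ⟩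
        x * inv v                                          ≡⟨ *-comm x (inv v) ⟩
        inv v * x                                          ∎
    ... | no T≢0 = scaling-onFibre (g T / T) (InFq-* (g-InFq T T∈) (InFq-inv T∈))
                     (x*y≢0 (g≢0 T∈ T≢0) (inv≢0 T≢0)) g/T≢1 Fbar≡g/T* g/T*T≡g
      where
      g/T*T≡g : (g T / T) * T ≡ g T
      g/T*T≡g = trans (*-assoc _ _ _) (trans (cong (g T *_) (inv*x≡1 T T≢0)) (*-identityʳ _))
      g/T≢1 : g T / T ≢ 1#
      g/T≢1 g/T≡1 = g≢id T∈ T≢0 (trans (sym g/T*T≡g) (trans (cong (_* T) g/T≡1) (*-identityˡ T)))
      Fbar≡g/T* : ∀ x → tr x ≡ T → Fbar g v x ≡ (g T / T) * x
      Fbar≡g/T* x trx≡T = begin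
        Fbar g v x                                         ≡⟨ Fbar-on x trx≡T ⟩
        x / v + (g T / T + inv v) * x * T ^ (q ∸ℕ 1)       ≡⟨ cong (λ z → x / v + (g T / T + inv v) * x * z) (^[q∸1]≡1 T∈ T≢0) ⟩
        x / v + (g T / T + inv v) * x * 1#                 ≡⟨ cong (x / v +_) (*-identityʳ _) ⟩
        x * inv v + (g T / T + inv v) * x                  ≡⟨ x*b+[a+b]*x≡a*x (g T / T) (inv v) x ⟩
        (g T / T) * x                                      ∎

    Fbar-isCPP : IsCPP (Fbar g v)
    Fbar-isCPP = isCPP-fibrewise (Fbar g v) g g-injective g+id-injective Fbar-onFibre

    module _ (u : Carrier) (u∈ : InFq u) (u≢0 : u ≢ 0#) where
      √u : Carrier
      √u = sqrt u

      A : Carrier → Carrier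
      A T = √u * g T * T + T * sqrt T

      β : Carrier → Carrier
      β T = T / (√u * g T) + √u * g T

      Σ₁ : Carrier → Carrier
      Σ₁ x = Σ< m (λ j → ((u ^ (2 ^ℕ j ∸ℕ 1)) / (v ^ (2 ^ℕ suc j ∸ℕ 1))) * frob j (S x))

      W : Carrier → Carrier → Carrier
      W T x = g T + √u * Σ< m (λ j → inv (β T) ^ (2 ^ℕ suc j ∸ℕ 1) * frob j (S x))

      Ftilde-on : ∀ x {T} → tr x ≡ T → Ftilde g v u x ≡
        ((1# + T ^ (q ∸ℕ 1)) * Σ₁ x + (T ^ (q ∸ℕ 1) + A T ^ (q ∸ℕ 1)) * sqrt (x / u)) + A T ^ (q ∸ℕ 1) * W T x
      Ftilde-on x = cong (λ T →
        ((1# + T ^ (q ∸ℕ 1)) * Σ₁ x + (T ^ (q ∸ℕ 1) + A T ^ (q ∸ℕ 1)) * sqrt (x / u)) + A T ^ (q ∸ℕ 1) * W T x)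

      √u∈ : InFq √u
      √u∈ = InFq-sqrt u∈

      √u≢0 : √u ≢ 0#
      √u≢0 √u≡0 = u≢0 (trans (sym (frob1-sqrt u)) (trans (cong (frob 1) √u≡0) (frob-0 1)))

      u^[2^j∸1]≡u⁻¹*frobj : ∀ j → u ^ (2 ^ℕ j ∸ℕ 1) ≡ inv u * frob j u
      u^[2^j∸1]≡u⁻¹*frobj j = sym (begin
        inv u * frob j u                   ≡⟨ cong (inv u *_) (x*x^[k∸1]≡x^k u (2 ^ℕ j) {{ℕₚ.m^n≢0 2 j}}) ⟨
        inv u * (u * u ^ (2 ^ℕ j ∸ℕ 1))    ≡⟨ *-assoc _ _ _ ⟨
        (inv u * u) * u ^ (2 ^ℕ j ∸ℕ 1)    ≡⟨ cong (_* u ^ (2 ^ℕ j ∸ℕ 1)) (inv*x≡1 u u≢0) ⟩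
        1# * u ^ (2 ^ℕ j ∸ℕ 1)             ≡⟨ *-identityˡ _ ⟩
        u ^ (2 ^ℕ j ∸ℕ 1)                  ∎)

      Σ₁≡DS : ∀ x → Σ₁ x ≡ DS (v * inv u) (inv v * inv v * u) x
      Σ₁≡DS x = begin
        Σ₁ x                                                  ≡⟨ Σ<-cong m term ⟩
        Σ< m (λ j → inv u * (inv v ^ k j * frob j (u * s)))   ≡⟨ *-distribˡ-Σ< m (inv u) _ ⟨
        inv u * Σ< m (λ j → inv v ^ k j * frob j (u * s))     ≡⟨ cong (inv u *_) (D-twist (inv v) v (inv*x≡1 v v≢0) (u * s)) ⟩
        inv u * (v * D (inv v * inv v * (u * s)))             ≡⟨ cong (λ y → inv u * (v * D y)) (*-assoc _ _ _) ⟨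
        inv u * (v * D (inv v * inv v * u * s))               ≡⟨ *-solve 3 (λ a b c → (a · (b · c)) ≐ ((b · a) · c)) refl _ _ _ ⟩
        DS (v * inv u) (inv v * inv v * u) x                  ∎
        where
        s : Carrier
        s = S x
        k : ℕ → ℕ
        k j = 2 ^ℕ suc j ∸ℕ 1
        term : ∀ j → ((u ^ (2 ^ℕ j ∸ℕ 1)) / (v ^ k j)) * frob j s ≡ inv u * (inv v ^ k j * frob j (u * s))
        term j = begin
          (u ^ (2 ^ℕ j ∸ℕ 1) * inv (v ^ k j)) * frob j s       ≡⟨ cong₂ (λ a b → (a * b) * frob j s) (u^[2^j∸1]≡u⁻¹*frobj j) (inv-^ v (k j)) ⟩
          ((inv u * frob j u) * inv v ^ k j) * frob j s        ≡⟨ *-solve 4 (λ a b c d → (((a · b) · c) · d) ≐ (a · (c · (b · d)))) refl _ _ _ _ ⟩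
          inv u * (inv v ^ k j * (frob j u * frob j s))        ≡⟨ cong (λ y → inv u * (inv v ^ k j * y)) (frob-* j u s) ⟨
          inv u * (inv v ^ k j * frob j (u * s))               ∎

      W≡g+DS : ∀ T x → β T ≢ 0# → W T x ≡ g T + DS (√u * β T) (inv (β T) * inv (β T)) x
      W≡g+DS T x βT≢0 = cong (g T +_) (begin
        √u * Σ< m (λ j → inv (β T) ^ (2 ^ℕ suc j ∸ℕ 1) * frob j (S x))   ≡⟨ cong (√u *_) (D-twist (inv (β T)) (β T) (inv*x≡1 (β T) βT≢0) (S x)) ⟩
        √u * (β T * D (inv (β T) * inv (β T) * S x))                     ≡⟨ *-assoc _ _ _ ⟨
        DS (√u * β T) (inv (β T) * inv (β T)) x                          ∎)

      Ftilde-onZeroFibre : AffineOnFibre (Ftilde g v u) g 0#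
      Ftilde-onZeroFibre = DS-onFibre (v * inv u) (inv v * inv v * u) 0#
        (InFq-* v∈ (InFq-inv u∈)) (InFq-* (InFq-* (InFq-inv v∈) (InFq-inv v∈)) u∈)
        (x*y≢0 v≢0 (inv≢0 u≢0)) (x*y≢0 (x*y≢0 (inv≢0 v≢0) (inv≢0 v≢0)) u≢0) InFq-0 (sym g-0)
        (trans (cong D (zeroʳ _)) (additive⇒0↦0 D-+)) Ftilde≡
        where
        A0≡0 : A 0# ≡ 0#
        A0≡0 = trans (cong₂ _+_ (zeroʳ _) (zeroˡ _)) (+-identityʳ 0#)
        Ftilde≡ : ∀ x → tr x ≡ 0# → Ftilde g v u x ≡ 0# + DS (v * inv u) (inv v * inv v * u) x
        Ftilde≡ x trx≡0 = begin
          Ftilde g v u x                                ≡⟨ Ftilde-on x trx≡0 ⟩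
          ((1# + 0# ^ (q ∸ℕ 1)) * Σ₁ x + (0# ^ (q ∸ℕ 1) + A 0# ^ (q ∸ℕ 1)) * sqrt (x / u)) + A 0# ^ (q ∸ℕ 1) * W 0# x
                                                        ≡⟨ cong₂ (λ t a → ((1# + t) * Σ₁ x + (t + a) * sqrt (x / u)) + a * W 0# x)
                                                             0^[q∸1]≡0 (trans (cong (_^ (q ∸ℕ 1)) A0≡0) 0^[q∸1]≡0) ⟩
          ((1# + 0#) * Σ₁ x + (0# + 0#) * sqrt (x / u)) + 0# * W 0# x  ≡⟨ select-00 _ _ _ ⟩
          Σ₁ x                                          ≡⟨ Σ₁≡DS x ⟩
          DS (v * inv u) (inv v * inv v * u) x          ≡⟨ +-identityˡ _ ⟨
          0# + DS (v * inv u) (inv v * inv v * u) x     ∎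

      -- On the fibres with A T = 0 we have √T = √u g(T), so T / u = g(T)².
      Ftilde-onDegenerateFibre : ∀ {T} → InFq T → T ≢ 0# → A T ≡ 0# → AffineOnFibre (Ftilde g v u) g T
      Ftilde-onDegenerateFibre {T} T∈ T≢0 AT≡0 =
        sqrt-scaling-onFibre (inv u) (InFq-inv u∈) (inv≢0 u≢0) Ftilde≡ √[T/u]≡g
        where
        w : Carrier
        w = √u * g T
        w≡√T : w ≡ sqrt T
        w≡√T = x+y≡0⇒x≡y w (sqrt T) (*-cancelˡ T _ 0# T≢0 (begin
          T * (w + sqrt T)          ≡⟨ distribˡ T w (sqrt T) ⟩
          T * w + T * sqrt T        ≡⟨ cong (_+ T * sqrt T) (*-comm T w) ⟩
          A T                       ≡⟨ AT≡0 ⟩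
          0#                        ≡⟨ zeroʳ T ⟨
          T * 0#                    ∎))
        √[T/u]≡g : sqrt (inv u * T) ≡ g T
        √[T/u]≡g = begin
          sqrt (inv u * T)                          ≡⟨ cong (λ y → sqrt (inv u * y)) (trans (sym (frob1-sqrt T)) (cong (frob 1) (sym w≡√T))) ⟩
          sqrt (inv u * frob 1 w)                   ≡⟨ cong (λ y → sqrt (inv u * y)) (frob-* 1 √u (g T)) ⟩
          sqrt (inv u * (frob 1 √u * frob 1 (g T))) ≡⟨ cong (λ y → sqrt (inv u * (y * frob 1 (g T)))) (frob1-sqrt u) ⟩
          sqrt (inv u * (u * frob 1 (g T)))         ≡⟨ cong sqrt (*-assoc _ _ _) ⟨
          sqrt ((inv u * u) * frob 1 (g T))         ≡⟨ cong (λ y → sqrt (y * frob 1 (g T))) (inv*x≡1 u u≢0) ⟩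
          sqrt (1# * frob 1 (g T))                  ≡⟨ cong sqrt (*-identityˡ _) ⟩
          sqrt (frob 1 (g T))                       ≡⟨ sqrt-frob1 (g T) ⟩
          g T                                       ∎
        Ftilde≡ : ∀ x → tr x ≡ T → Ftilde g v u x ≡ sqrt (x / u)
        Ftilde≡ x trx≡T = begin
          Ftilde g v u x                                ≡⟨ Ftilde-on x trx≡T ⟩
          ((1# + T ^ (q ∸ℕ 1)) * Σ₁ x + (T ^ (q ∸ℕ 1) + A T ^ (q ∸ℕ 1)) * sqrt (x / u)) + A T ^ (q ∸ℕ 1) * W T x
                                                        ≡⟨ cong₂ (λ t a → ((1# + t) * Σ₁ x + (t + a) * sqrt (x / u)) + a * W T x)
                                                             (^[q∸1]≡1 T∈ T≢0) (trans (cong (_^ (q ∸ℕ 1)) AT≡0) 0^[q∸1]≡0) ⟩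
          ((1# + 1#) * Σ₁ x + (1# + 0#) * sqrt (x / u)) + 0# * W T x  ≡⟨ select-10 _ _ _ ⟩
          sqrt (x / u)                                  ∎

      -- Here W T = g T + DS (√u β) β⁻², and β⁻² T = t + t² with t = T / (T + w²) ∈ F_q,
      -- which D annihilates.
      module NondegenerateFibre {T : Carrier} (T∈ : InFq T) (T≢0 : T ≢ 0#) (AT≢0 : A T ≢ 0#) where
        w Z : Carrier
        w = √u * g T
        Z = T + w * w

        w∈ : InFq w
        w∈ = InFq-* √u∈ (g-InFq T T∈)

        w≢0 : w ≢ 0#
        w≢0 = x*y≢0 √u≢0 (g≢0 T∈ T≢0)

        Z≢0 : Z ≢ 0#
        Z≢0 Z≡0 = AT≢0 (begin
          w * T + T * sqrt T   ≡⟨ cong (λ y → w * T + T * y) √T≡w ⟩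
          w * T + T * w        ≡⟨ cong (w * T +_) (*-comm T w) ⟩
          w * T + w * T        ≡⟨ x+x≡0 _ ⟩
          0#                   ∎)
          where
          √T≡w : sqrt T ≡ w
          √T≡w = trans (cong sqrt (trans (x+y≡0⇒x≡y T (w * w) Z≡0) (sym (frob1≡x*x w)))) (sqrt-frob1 w)

        βw≡Z : β T * w ≡ Z
        βw≡Z = begin
          (T * inv w + w) * w        ≡⟨ distribʳ w _ _ ⟩
          T * inv w * w + w * w      ≡⟨ cong (_+ w * w) (trans (*-assoc _ _ _) (trans (cong (T *_) (inv*x≡1 w w≢0)) (*-identityʳ T))) ⟩
          Z                          ∎

        β≢0 : β T ≢ 0#
        β≢0 β≡0 = Z≢0 (trans (sym βw≡Z) (trans (cong (_* w) β≡0) (zeroˡ w)))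

        β∈ : InFq (β T)
        β∈ = InFq-+ (InFq-* T∈ (InFq-inv w∈)) w∈

        β⁻¹≡wZ⁻¹ : inv (β T) ≡ w * inv Z
        β⁻¹≡wZ⁻¹ = inv-unique (β T) (w * inv Z)
          (trans (sym (*-assoc _ _ _)) (trans (cong (_* inv Z) βw≡Z) (x*inv≡1 Z Z≢0)))

        D[δT]≡0 : D (inv (β T) * inv (β T) * T) ≡ 0#
        D[δT]≡0 = begin
          D (inv (β T) * inv (β T) * T)           ≡⟨ cong (λ y → D (y * y * T)) β⁻¹≡wZ⁻¹ ⟩
          D ((w * inv Z) * (w * inv Z) * T)       ≡⟨ cong D ([wZ⁻¹]²T≡t+t² T w (inv Z) (x*inv≡1 Z Z≢0)) ⟩
          D (T * inv Z + frob 1 (T * inv Z))      ≡⟨ D[t+frob1t]≡0 (InFq-* T∈ (InFq-inv (InFq-+ T∈ (InFq-* w∈ w∈)))) ⟩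
          0#                                      ∎

        Ftilde≡ : ∀ x → tr x ≡ T → Ftilde g v u x ≡ g T + DS (√u * β T) (inv (β T) * inv (β T)) x
        Ftilde≡ x trx≡T = begin
          Ftilde g v u x                                ≡⟨ Ftilde-on x trx≡T ⟩
          ((1# + T ^ (q ∸ℕ 1)) * Σ₁ x + (T ^ (q ∸ℕ 1) + A T ^ (q ∸ℕ 1)) * sqrt (x / u)) + A T ^ (q ∸ℕ 1) * W T x
                                                        ≡⟨ cong₂ (λ t a → ((1# + t) * Σ₁ x + (t + a) * sqrt (x / u)) + a * W T x)
                                                             (^[q∸1]≡1 T∈ T≢0) (^[q∸1]≡1 A∈ AT≢0) ⟩
          ((1# + 1#) * Σ₁ x + (1# + 1#) * sqrt (x / u)) + 1# * W T x  ≡⟨ select-11 _ _ _ ⟩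
          W T x                                         ≡⟨ W≡g+DS T x β≢0 ⟩
          g T + DS (√u * β T) (inv (β T) * inv (β T)) x ∎
          where
          A∈ : InFq (A T)
          A∈ = InFq-+ (InFq-* w∈ T∈) (InFq-* T∈ (InFq-sqrt T∈))

        onFibre : AffineOnFibre (Ftilde g v u) g T
        onFibre = DS-onFibre (√u * β T) (inv (β T) * inv (β T)) (g T)
          (InFq-* √u∈ β∈) (InFq-* (InFq-inv β∈) (InFq-inv β∈))
          (x*y≢0 √u≢0 β≢0) (x*y≢0 (inv≢0 β≢0) (inv≢0 β≢0)) (g-InFq T T∈) refl D[δT]≡0 Ftilde≡

      Ftilde-onFibre : ∀ T → InFq T → AffineOnFibre (Ftilde g v u) g T
      Ftilde-onFibre T T∈ with T ≟ 0# | A T ≟ 0#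
      ... | yes refl | _        = Ftilde-onZeroFibre
      ... | no T≢0   | yes AT≡0 = Ftilde-onDegenerateFibre T∈ T≢0 AT≡0
      ... | no T≢0   | no AT≢0  = NondegenerateFibre.onFibre T∈ T≢0 AT≢0

      Ftilde-isCPP : IsCPP (Ftilde g v u)
      Ftilde-isCPP = isCPP-fibrewise (Ftilde g v u) g g-injective g+id-injective Ftilde-onFibre

theorem10 : ∀ {c} (m n : ℕ) → NonZero m → NonZero n → n % 2 ≡ 1 →
    (K : Field c) → let open Setting m n K in
    Fin Q ↔ Carrier →
    (a : ℕ → Carrier) → (∀ i → InFq (a i)) →
    (v : Carrier) → InFq v → v ≢ 0# → v ≢ 1# →
    IsCPPFq (λ x → x * Lpoly a x + v * x) →
    (gs : List Carrier) → All InFq gs →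
    (∀ x → InFq x → eval gs (x * Lpoly a x + v * x) ≡ x) →
    (∀ x → InFq x → (λ y → y * Lpoly a y + v * y) (eval gs x) ≡ x) →
    IsCPP (Fbar (eval gs) v)
    × (∀ u → InFq u → u ≢ 0# → IsCPP (Ftilde (eval gs) v u))
theorem10 m n m≢0 n≢0 n-odd K φ a _ v v∈ v≢0 v≢1 (_ , _ , f+id-injective , _) gs gs∈ g∘f≡id f∘g≡id =
  Fbar-isCPP , Ftilde-isCPP
  where
  open Setting m n K
  open FieldProperties K
  open TraceSetting m n {{m≢0}} {{n≢0}} n-odd K φ
  f : Carrier → Carrier
  f x = x * Lpoly a x + v * x
  f0≡0 : f 0# ≡ 0#
  f0≡0 = trans (cong₂ _+_ (zeroˡ _) (zeroʳ v)) (+-identityʳ 0#)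
  open CompletePermutations f (eval gs) (λ _ → eval-InFq gs∈) f0≡0 g∘f≡id f∘g≡id f+id-injective v v∈ v≢0 v≢1
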